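{- Let $X=\{x,y,z\}$, $N=\{1,\dots,n\}$ with $n\ge 3$, and let $g:NP\to X$ be strategy-proof with $\mathrm{Range}(g|NP^{*})=\{x\}$. If $u\in NP$ and $g(u)=y$, then no individual in $\{1,2,\dots,n-2\}$ has $y$ ranked at the bottom of his ordering at $u$.
   Context: A profile is a map $p:N\to L(X)$, where $L(X)$ is the set of strict linear orderings of $X$; write $a\succ_{p(i)}b$ if individual $i$ strictly prefers $a$ to $b$ at $p$. $NP$ is the set of all profiles $p$ such that for every pair of distinct alternatives $a,b$ there exist individuals $i,j$ with $a\succ_{p(i)}b$ and $b\succ_{p(j)}a$. $NP^{*}$ is the set of profiles $u\in NP$ with $u(n-1)=u(n)$. Two profiles $p,q$ are $h$-variants if $q(i)=p(i)$ for all $i\neq h$. A rule $g:NP\to X$ is strategy-proof if there are no $h\in N$ and $h$-variants $p,p'\in NP$ with $g(p')\succ_{p(h)}g(p)$. -}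

module Defs where

open import Data.Nat using (ℕ; suc; _+_; _≥_)
open import Data.Fin using (Fin; zero; suc; toℕ; _<_)
open import Data.Nat as ℕ using ()
open import Data.Product using (Σ; ∃; ∃-syntax; _×_; _,_)
open import Function.Definitions using (Injective)
open import Relation.Binary.PropositionalEquality using (_≡_; _≢_)
open import Relation.Nullary using (¬_)

X : Set
X = Fin 3

x y z : X
x = zero
y = suc zero
z = suc (suc zero)

-- A strict linear ordering of X, given by the (injective, hence bijective)
-- rank function: position 0 is the top, position 2 the bottom.
record LinOrd : Set where
  constructor linOrd
  field
    rank    : X → Fin 3
    rankInj : Injective _≡_ _≡_ rank
open LinOrd public

_≻[_]_ : X → LinOrd → X → Set
a ≻[ R ] b = rank R a < rank R b

AtBottom : LinOrd → X → Set
AtBottom R a = ∀ b → b ≢ a → b ≻[ R ] a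

-- Individuals N = {1,…,n} encoded as Fin n (individual i+1 is index i).
Profile : ℕ → Set
Profile n = Fin n → LinOrd

NP : ∀ {n} → Profile n → Set
NP {n} p = ∀ a b → a ≢ b → ∃[ i ] ∃[ j ] (a ≻[ p i ] b × b ≻[ p j ] a)

Variant : ∀ {n} → Fin n → Profile n → Profile n → Set
Variant h p q = ∀ i → i ≢ h → q i ≡ p i

-- Strategy-proofness of a rule g on NP (g is given on all profiles; only
-- its values on NP matter).
StrategyProof : ∀ {n} → (Profile n → X) → Set
StrategyProof {n} g =
  ∀ (h : Fin n) (p p′ : Profile n) → NP p → NP p′ → Variant h p p′ →
  ¬ (g p′ ≻[ p h ] g p)

-- Individuals n-1 and n (indices n-2 and n-1), for n = m + 2.
indNm1 : ∀ m → Fin (m + 2)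
indNm1 m = Data.Fin.fromℕ< {m} (lem m)
  where
  lem : ∀ m → m ℕ.< m + 2
  lem ℕ.zero = ℕ.s≤s ℕ.z≤n
  lem (ℕ.suc m) = ℕ.s≤s (lem m)

indN : ∀ m → Fin (m + 2)
indN m = Data.Fin.fromℕ< {ℕ.suc m} (lem m)
  where
  lem : ∀ m → ℕ.suc m ℕ.< m + 2
  lem ℕ.zero = ℕ.s≤s (ℕ.s≤s ℕ.z≤n)
  lem (ℕ.suc m) = ℕ.s≤s (lem m)

NP* : ∀ m → Profile (m + 2) → Set
NP* m u = NP u × u (indNm1 m) ≡ u (indN m)

RangeNP*IsX : ∀ m → (Profile (m + 2) → X) → Set
RangeNP*IsX m g =
  (∀ u → NP* m u → g u ≡ x) × (∃[ u ] (NP* m u × g u ≡ x))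

module Submission where

-- Suppose g(u) = y and some individual i ≤ n-2 ranks y at the
-- bottom of u(i).  Let T be the reverse of u(i); it ranks y at the top.
-- Since every profile containing both an ordering and its reverse lies in NP,
-- replacing first the ordering of individual n-1 and then that of individual
-- n by T keeps us inside NP (individual i still holds u(i)).  Strategy-
-- proofness forbids the outcome from leaving y when an individual switches to
-- an ordering with y on top: otherwise, with true preference T, he would
-- manipulate back to the old profile, whose outcome y is his favourite.  So
-- g stays y at the final profile, which lies in NP* and hence has outcome x.

open import Defs
open import Data.Nat using (ℕ; suc; s≤s; _+_; _≥_; _<_)
open import Data.Nat.Properties using (<-irrefl; <-trans; n<1+n; ∸-monoʳ-<)
open import Data.Fin using (Fin; toℕ; opposite; _≟_)
import Data.Fin as Fin
open import Data.Fin.Properties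
  using (<-cmp; toℕ-fromℕ<; toℕ<n; opposite-prop; opposite-involutive)
open import Data.Vec.Functional using (updateAt)
open import Data.Vec.Functional.Properties using (updateAt-updates; updateAt-minimal)
open import Data.Product using (_,_; proj₁)
open import Function using (const)
open import Relation.Binary.Definitions using (tri<; tri≈; tri>)
open import Relation.Binary.PropositionalEquality
open import Relation.Nullary using (¬_; yes; no)
open import Data.Empty using (⊥-elim)

opposite-reverses-< : ∀ {n} {i j : Fin n} → i Fin.< j → opposite j Fin.< opposite i
opposite-reverses-< {i = i} {j} i<j
  rewrite opposite-prop i | opposite-prop j = ∸-monoʳ-< (s≤s i<j) (toℕ<n j)

opposite-injective : ∀ {n} {i j : Fin n} → opposite i ≡ opposite j → i ≡ j
opposite-injective {i = i} {j} e =
  trans (sym (opposite-involutive i)) (trans (cong opposite e) (opposite-involutive j))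

reverse : LinOrd → LinOrd
reverse R = linOrd (λ a → opposite (rank R a)) (λ e → rankInj R (opposite-injective e))

reverse-flips : ∀ R {a b} → a ≻[ R ] b → b ≻[ reverse R ] a
reverse-flips R = opposite-reverses-<

reverse-bottom-is-top : ∀ R {a} → AtBottom R a → ∀ b → b ≢ a → a ≻[ reverse R ] b
reverse-bottom-is-top R bottom b b≢a = reverse-flips R (bottom b b≢a)

NP-of-opposed : ∀ {n} (p : Profile n) {i k : Fin n} (R : LinOrd) →
  p i ≡ R → p k ≡ reverse R → NP p
NP-of-opposed p {i} {k} R refl pk≡rev a b a≢b with <-cmp (rank R a) (rank R b)
... | tri< a≻b _ _ = i , k , a≻b , subst (λ S → b ≻[ S ] a) (sym pk≡rev) (reverse-flips R a≻b)
... | tri≈ _ same _ = ⊥-elim (a≢b (rankInj R same))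
... | tri> _ _ b≻a = k , i , subst (λ S → a ≻[ S ] b) (sym pk≡rev) (reverse-flips R b≻a) , b≻a

replace : ∀ {n} → Profile n → Fin n → LinOrd → Profile n
replace p h R = updateAt p h (const R)

replace-here : ∀ {n} (p : Profile n) h R → replace p h R h ≡ R
replace-here p h R = updateAt-updates h p

replace-elsewhere : ∀ {n} (p : Profile n) {h} R {j} → j ≢ h → replace p h R j ≡ p j
replace-elsewhere p {h} R {j} j≢h = updateAt-minimal j h p j≢h

-- If g(p) = a and individual h switches to an ordering T with a on top (both
-- profiles in NP), the outcome stays a: otherwise h, truly holding T, would
-- gain by reporting his old ordering instead.
top-stays : ∀ {n} (g : Profile n → X) → StrategyProof g →
  (p : Profile n) (h : Fin n) (T : LinOrd) {a : X} →
  (∀ b → b ≢ a → a ≻[ T ] b) → NP p → NP (replace p h T) →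
  g p ≡ a → g (replace p h T) ≡ a
top-stays g sp p h T {a} a-top np np′ gp≡a with g (replace p h T) ≟ a
... | yes stayed = stayed
... | no moved = ⊥-elim (sp h (replace p h T) p np′ np variant manipulation)
  where
  variant : Variant h (replace p h T) p
  variant j j≢h = sym (replace-elsewhere p T j≢h)
  manipulation : g p ≻[ replace p h T h ] g (replace p h T)
  manipulation rewrite gp≡a | replace-here p h T = a-top _ moved

toℕ-indNm1 : ∀ m → toℕ (indNm1 m) ≡ m
toℕ-indNm1 m = toℕ-fromℕ< _

toℕ-indN : ∀ m → toℕ (indN m) ≡ suc m
toℕ-indN m = toℕ-fromℕ< _

≢-by-toℕ : ∀ {n} {i j : Fin n} → toℕ i < toℕ j → i ≢ j
≢-by-toℕ i<j refl = <-irrefl refl i<j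

mainTheorem6 : (m : ℕ) → m ≥ 1 → (g : Profile (m + 2) → X) →
    StrategyProof g → RangeNP*IsX m g →
    (u : Profile (m + 2)) → NP u → g u ≡ y →
    (i : Fin (m + 2)) → toℕ i < m → ¬ AtBottom (u i) y
mainTheorem6 m _ g sp range u npu gu≡y i i<m y-bottom = x≢y (trans (sym gu₂≡x) gu₂≡y)
  where
  T = reverse (u i)
  n-1 = indNm1 m
  n = indN m
  i≢n-1 : i ≢ n-1
  i≢n-1 = ≢-by-toℕ (subst (toℕ i <_) (sym (toℕ-indNm1 m)) i<m)
  i≢n : i ≢ n
  i≢n = ≢-by-toℕ (subst (toℕ i <_) (sym (toℕ-indN m)) (<-trans i<m (n<1+n m)))
  n-1≢n : n-1 ≢ n
  n-1≢n = ≢-by-toℕ (subst₂ _<_ (sym (toℕ-indNm1 m)) (sym (toℕ-indN m)) (n<1+n m))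
  u₁ = replace u n-1 T
  u₂ = replace u₁ n T
  u₂-n-1 : u₂ n-1 ≡ T
  u₂-n-1 = trans (replace-elsewhere u₁ T n-1≢n) (replace-here u n-1 T)
  u₂-i : u₂ i ≡ u i
  u₂-i = trans (replace-elsewhere u₁ T i≢n) (replace-elsewhere u T i≢n-1)
  np₁ = NP-of-opposed u₁ (u i) (replace-elsewhere u T i≢n-1) (replace-here u n-1 T)
  np₂ = NP-of-opposed u₂ (u i) u₂-i u₂-n-1
  y-top = reverse-bottom-is-top (u i) y-bottom
  gu₂≡y : g u₂ ≡ y
  gu₂≡y = top-stays g sp u₁ n T y-top np₁ np₂ (top-stays g sp u n-1 T y-top npu np₁ gu≡y)
  gu₂≡x : g u₂ ≡ x
  gu₂≡x = proj₁ range u₂ (np₂ , trans u₂-n-1 (sym (replace-here u₁ n T)))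
  x≢y : x ≢ y
  x≢y ()
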